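{- Let $(u_n)_{n\ge1}$ be the sequence defined by $u_1=1$, $u_2=2$, $u_3=3$ and, for all $n\ge2$, $u_{2n}=u_{2n-1}+u_{2n-2}$ and $u_{2n+1}=u_{2n}+u_{2n-2}$. Then the set of positive integer solutions $(x,y)$ of $x^2-2y^2=-1$ is exactly $\{(1,1)\}\cup\{(u_{4n+1},u_{4n}) : n\ge1\}$. -}

module Defs where

open import Data.Nat using (ℕ; zero; suc; _+_; _*_)
open import Data.Product using (_×_; _,_; proj₁; proj₂)

-- P k = (u (2k+2), u (2k+3)) for k ≥ 0, where
-- P 0 = (u 2, u 3) = (2, 3) and, for n ≥ 2,
--   u(2n) = u(2n-1) + u(2n-2),  u(2n+1) = u(2n) + u(2n-2).
P : ℕ → ℕ × ℕ
P zero = 2 , 3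
P (suc k) with P k
... | a , b = b + a , (b + a) + a

-- uFrom k m = u (2k + 2 + m)
uFrom : ℕ → ℕ → ℕ
uFrom k zero = proj₁ (P k)
uFrom k (suc zero) = proj₂ (P k)
uFrom k (suc (suc m)) = uFrom (suc k) m

-- The paper's sequence u_n (n ≥ 1); u 0 = 0 is an unused junk value.
u : ℕ → ℕ
u zero = 0
u (suc zero) = 1
u (suc (suc m)) = uFrom 0 m

{-# OPTIONS --safe #-}
module Submission where

-- The map (a , b) ↦ (a + b , 2a + b) generates u two terms at a time, starting from
-- (0 , 1).  It satisfies (2a + b)² + b² = 2(a + b)² + 2a², so it exchanges the Pell
-- equations b² = 2a² + 1 and b² + 1 = 2a².  Conversely a solution (a , b) of either
-- equation with a ≥ 1 satisfies a ≤ b < 2a, hence is the image of (b − a , 2a − b),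
-- again a solution of the other equation with smaller first entry.  By descent, the
-- solutions of b² + 1 = 2a² are exactly the odd-indexed points of the orbit of (0 , 1).

open import Defs
open import Data.Nat using (ℕ; zero; suc; _+_; _*_; _∸_; _≤_; _<_; z≤n; s≤s)
open import Data.Nat.Properties
open import Data.Nat.Induction using (<-wellFounded)
open import Data.Nat.Tactic.RingSolver using (solve-∀)
open import Data.Product using (_×_; _,_; Σ; ∃-syntax; proj₁; proj₂; uncurry)
open import Data.Sum using (_⊎_; inj₁; inj₂)
open import Function.Bundles using (_⇔_; mk⇔; Equivalence)
open import Induction.WellFounded using (Acc; acc)
open import Relation.Nullary using (contradiction)
open import Relation.Binary.PropositionalEquality
  using (_≡_; refl; sym; trans; cong; cong₂; subst; module ≡-Reasoning)

-- Points are pairs (a , b) = (u (2i) , u (2i + 1)), i.e. (y , x) in the theorem.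
step : ℕ × ℕ → ℕ × ℕ
step (a , b) = b + a , b + a + a

orbit : ℕ → ℕ × ℕ
orbit zero = 0 , 1
orbit (suc n) = step (orbit n)

Pell⁺ : ℕ × ℕ → Set
Pell⁺ (a , b) = b * b ≡ 2 * (a * a) + 1

Pell⁻ : ℕ × ℕ → Set
Pell⁻ (a , b) = b * b + 1 ≡ 2 * (a * a)

step-norm : ∀ a b →
  (b + a + a) * (b + a + a) + b * b ≡ 2 * ((b + a) * (b + a)) + 2 * (a * a)
step-norm = solve-∀

+-exchange-1 : ∀ {x y z w} → x + y ≡ z + w → (y ≡ w + 1 ⇔ x + 1 ≡ z)
+-exchange-1 {x} {y} {z} {w} e = mk⇔ to from
  where
  open ≡-Reasoning
  to : y ≡ w + 1 → x + 1 ≡ z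
  to y≡w+1 = +-cancelʳ-≡ w (x + 1) z (begin
    x + 1 + w   ≡⟨ +-assoc x 1 w ⟩
    x + (1 + w) ≡⟨ cong (x +_) (trans (+-comm 1 w) (sym y≡w+1)) ⟩
    x + y       ≡⟨ e ⟩
    z + w       ∎)
  from : x + 1 ≡ z → y ≡ w + 1
  from x+1≡z = +-cancelˡ-≡ x y (w + 1) (begin
    x + y       ≡⟨ e ⟩
    z + w       ≡⟨ cong (_+ w) (sym x+1≡z) ⟩
    x + 1 + w   ≡⟨ +-assoc x 1 w ⟩
    x + (1 + w) ≡⟨ cong (x +_) (+-comm 1 w) ⟩
    x + (w + 1) ∎)

Pell⁺⇔Pell⁻-step : ∀ p → Pell⁺ p ⇔ Pell⁻ (step p)
Pell⁺⇔Pell⁻-step (a , b) = +-exchange-1 (step-norm a b)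

Pell⁻⇔Pell⁺-step : ∀ p → Pell⁻ p ⇔ Pell⁺ (step p)
Pell⁻⇔Pell⁺-step (a , b) = mk⇔
  (λ h → sym (Equivalence.to exchange (sym h)))
  (λ h → sym (Equivalence.from exchange (sym h)))
  where exchange = +-exchange-1 (sym (step-norm a b))

orbit-Pell± : ∀ m → Pell⁺ (orbit (m + m)) × Pell⁻ (orbit (suc (m + m)))
orbit-Pell± zero = refl , refl
orbit-Pell± (suc m) = even , Equivalence.to (Pell⁺⇔Pell⁻-step (orbit (suc m + suc m))) even
  where
  even : Pell⁺ (orbit (suc m + suc m))
  even = subst (λ n → Pell⁺ (orbit n)) (cong suc (sym (+-suc m m)))
           (Equivalence.to (Pell⁻⇔Pell⁺-step (orbit (suc (m + m)))) (proj₂ (orbit-Pell± m)))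

NearPell : ℕ × ℕ → Set
NearPell (a , b) = 2 * (a * a) ≤ b * b + 1 × b * b ≤ 2 * (a * a) + 1

Pell⁺⇒NearPell : ∀ p → Pell⁺ p → NearPell p
Pell⁺⇒NearPell (a , b) e =
  ≤-trans (m≤m+n (2 * (a * a)) 1) (≤-trans (≤-reflexive (sym e)) (m≤m+n (b * b) 1)) , ≤-reflexive e

Pell⁻⇒NearPell : ∀ p → Pell⁻ p → NearPell p
Pell⁻⇒NearPell (a , b) e =
  ≤-reflexive (sym e) , ≤-trans (m≤m+n (b * b) 1) (≤-trans (≤-reflexive e) (m≤m+n (2 * (a * a)) 1))

NearPell⇒a≤b<a+a : ∀ {a b} → 1 ≤ a → NearPell (a , b) → a ≤ b × b < a + a
NearPell⇒a≤b<a+a {a} {b} 1≤a (lower , upper) = a≤b , b<a+a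
  where
  1≤a² : 1 ≤ a * a
  1≤a² = *-mono-≤ 1≤a 1≤a
  a²≤b² : a * a ≤ b * b
  a²≤b² = +-cancelʳ-≤ 1 (a * a) (b * b)
    (≤-trans (+-monoʳ-≤ (a * a) 1≤a²) (subst (_≤ b * b + 1) (cong (a * a +_) (+-identityʳ (a * a))) lower))
  a≤b : a ≤ b
  a≤b = ≮⇒≥ (λ b<a → <⇒≱ (*-mono-< b<a b<a) a²≤b²)
  b²<[a+a]² : b * b < (a + a) * (a + a)
  b²<[a+a]² = begin-strict
    b * b                     ≤⟨ upper ⟩
    2 * (a * a) + 1           <⟨ +-monoʳ-< (2 * (a * a)) (*-monoʳ-≤ 2 1≤a²) ⟩
    2 * (a * a) + 2 * (a * a) ≡⟨ square-of-double a ⟩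
    (a + a) * (a + a)         ∎
    where
    open ≤-Reasoning
    square-of-double : ∀ a → 2 * (a * a) + 2 * (a * a) ≡ (a + a) * (a + a)
    square-of-double = solve-∀
  b<a+a : b < a + a
  b<a+a = ≰⇒> (λ a+a≤b → <⇒≱ b²<[a+a]² (*-mono-≤ a+a≤b a+a≤b))

step-preimage : ∀ {a b} → a ≤ b → b < a + a → ∃[ q ] step q ≡ (a , b) × proj₁ q < a
step-preimage {a} {b} a≤b b<a+a = (d , c) , cong₂ _,_ c+d≡a (trans (cong (_+ d) c+d≡a) a+d≡b) , d<a
  where
  d = b ∸ a
  a+d≡b : a + d ≡ b
  a+d≡b = m+[n∸m]≡n a≤b
  d<a : d < a
  d<a = +-cancelˡ-< a d a (subst (_< a + a) (sym a+d≡b) b<a+a)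
  c = a ∸ d
  c+d≡a : c + d ≡ a
  c+d≡a = trans (+-comm c d) (m+[n∸m]≡n (<⇒≤ d<a))

predecessor : ∀ {a b} → 1 ≤ a → NearPell (a , b) → ∃[ q ] step q ≡ (a , b) × proj₁ q < a
predecessor 1≤a near = uncurry step-preimage (NearPell⇒a≤b<a+a 1≤a near)

Pell⁺⇒even-orbit : ∀ {a b} → Acc _<_ a → Pell⁺ (a , b) → ∃[ m ] orbit (m + m) ≡ (a , b)
Pell⁻⇒odd-orbit : ∀ {a b} → Acc _<_ a → Pell⁻ (a , b) → ∃[ m ] orbit (suc (m + m)) ≡ (a , b)

Pell⁺⇒even-orbit {zero} {b} _ e = 0 , cong (0 ,_) (sym (m*n≡1⇒n≡1 b b e))
Pell⁺⇒even-orbit {suc a} {b} (acc rec) e with predecessor (s≤s z≤n) (Pell⁺⇒NearPell (suc a , b) e)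
... | q , step-q≡ , q<a with Pell⁻⇒odd-orbit (rec q<a) Pell⁻-q
  where
  Pell⁻-q : Pell⁻ q
  Pell⁻-q = Equivalence.from (Pell⁻⇔Pell⁺-step q) (subst Pell⁺ (sym step-q≡) e)
... | m , orbit≡q = suc m , (begin
  orbit (suc m + suc m)      ≡⟨ cong (λ n → orbit (suc n)) (+-suc m m) ⟩
  step (orbit (suc (m + m))) ≡⟨ cong step orbit≡q ⟩
  step q                     ≡⟨ step-q≡ ⟩
  (suc a , b)                ∎)
  where open ≡-Reasoning

Pell⁻⇒odd-orbit {zero} {b} _ e = contradiction (trans (+-comm 1 (b * b)) e) λ ()
Pell⁻⇒odd-orbit {suc a} {b} (acc rec) e with predecessor (s≤s z≤n) (Pell⁻⇒NearPell (suc a , b) e)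
... | q , step-q≡ , q<a with Pell⁺⇒even-orbit (rec q<a) Pell⁺-q
  where
  Pell⁺-q : Pell⁺ q
  Pell⁺-q = Equivalence.from (Pell⁺⇔Pell⁻-step q) (subst Pell⁻ (sym step-q≡) e)
... | m , orbit≡q = m , trans (cong step orbit≡q) step-q≡

Pell⁻⇔odd-orbit : ∀ p → Pell⁻ p ⇔ (∃[ m ] orbit (suc (m + m)) ≡ p)
Pell⁻⇔odd-orbit p = mk⇔ (Pell⁻⇒odd-orbit (<-wellFounded _)) λ { (m , refl) → proj₂ (orbit-Pell± m) }

P≡orbit : ∀ k → P k ≡ orbit (2 + k)
P≡orbit zero = refl
P≡orbit (suc k) = cong step (P≡orbit k)

uFrom-skip : ∀ k j r → uFrom k (j + j + r) ≡ uFrom (j + k) r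
uFrom-skip k zero r = refl
uFrom-skip k (suc j) r rewrite +-suc j j | uFrom-skip (suc k) j r | +-suc j k = refl

u-orbit : ∀ k → (u (4 * suc k) , u (4 * suc k + 1)) ≡ orbit (suc (suc k + suc k))
u-orbit k = begin
  (u (4 * suc k) , u (4 * suc k + 1))             ≡⟨ cong₂ (λ i i′ → u i , u i′) (even-index k) (odd-index k) ⟩
  (uFrom 0 (j + j + 0) , uFrom 0 (j + j + 1))     ≡⟨ cong₂ _,_ (uFrom-skip 0 j 0) (uFrom-skip 0 j 1) ⟩
  P (j + 0)                                       ≡⟨ P≡orbit (j + 0) ⟩
  orbit (2 + (j + 0))                             ≡⟨ cong orbit (orbit-index k) ⟩
  orbit (suc (suc k + suc k))                     ∎
  where
  open ≡-Reasoning
  j = suc (k + k)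
  even-index : ∀ k → 4 * suc k ≡ 2 + (suc (k + k) + suc (k + k) + 0)
  even-index = solve-∀
  odd-index : ∀ k → 4 * suc k + 1 ≡ 2 + (suc (k + k) + suc (k + k) + 1)
  odd-index = solve-∀
  orbit-index : ∀ k → 2 + (suc (k + k) + 0) ≡ suc (suc k + suc k)
  orbit-index = solve-∀

lemma11 : (x y : ℕ) → 1 ≤ x → 1 ≤ y →
    (x * x + 1 ≡ 2 * (y * y)) ⇔
      (((x ≡ 1) × (y ≡ 1)) ⊎ Σ ℕ (λ n → (1 ≤ n) × (x ≡ u (4 * n + 1)) × (y ≡ u (4 * n))))
lemma11 x y _ _ = mk⇔ to from
  where
  to : Pell⁻ (y , x) → ((x ≡ 1) × (y ≡ 1)) ⊎ Σ ℕ (λ n → (1 ≤ n) × (x ≡ u (4 * n + 1)) × (y ≡ u (4 * n)))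
  to sol with Equivalence.to (Pell⁻⇔odd-orbit (y , x)) sol
  ... | zero , refl = inj₁ (refl , refl)
  ... | suc k , orbit≡ = inj₂ (suc k , s≤s z≤n , cong proj₂ u≡ , cong proj₁ u≡)
    where u≡ = sym (trans (u-orbit k) orbit≡)
  from : ((x ≡ 1) × (y ≡ 1)) ⊎ Σ ℕ (λ n → (1 ≤ n) × (x ≡ u (4 * n + 1)) × (y ≡ u (4 * n))) → Pell⁻ (y , x)
  from (inj₁ (refl , refl)) = refl
  from (inj₂ (suc k , _ , refl , refl)) = Equivalence.from (Pell⁻⇔odd-orbit _) (suc k , sym (u-orbit k))
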